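{- Let $X\subseteq2^\omega$. If for every partitioning real $d$, $X$ goes through some $d$-binary slalom, then $\mathcal{F}_X$ is rapid.
   Context: Subsets of $\omega$ are identified with elements of $2^\omega$; a natural number $n$ is identified with $\{0,\dots,n-1\}$. For distinct $x,y\in2^\omega$ let $h(x,y)=\min\{n:x(n)\ne y(n)\}$; $H(X)=\{h(x,y):x,y\in X,x\ne y\}$. The Raisonnier filter $\mathcal{F}_X$ is the set of all $a\subseteq\omega$ for which there are $Y_n\subseteq2^\omega$ ($n<\omega$) with $X\subseteq\bigcup_nY_n$ and $a\supseteq\bigcup_nH(Y_n)$. A filter $\mathcal{F}$ on $\omega$ (the trivial filter $\mathcal{P}(\omega)$ included) is rapid if for every increasing $f\in\omega^\omega$ there is $a\in\mathcal{F}$ with $|a\cap f(n)|\le n$ for all $n$. A partitioning real is a strictly increasing $d\in\omega^\omega$ with $d(0)=0$; $I^d_n=[d(n),d(n+1))$. A $d$-binary slalom is a function $B$ on $\omega$ with $B(n)\subseteq\{0,1\}^{|I^d_n|}$ and $|B(n)|\le n$ for all $n$; $X$ goes through $B$ if for every $x\in X$, $x\restriction I^d_n\in B(n)$ for all but finitely many $n$. -}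

module Defs where

open import Data.Nat using (ℕ; zero; suc; _+_; _∸_; _≤_; _<_)
open import Data.Bool using (Bool; true; false)
open import Data.Fin using (Fin; toℕ)
open import Data.Vec using (Vec; tabulate)
open import Data.List using (List; length)
open import Data.List.Membership.Propositional using (_∈_)
open import Data.Product using (Σ; ∃; _×_)
open import Relation.Binary.PropositionalEquality using (_≡_; _≢_)

-- Cantor space 2^ω; subsets of ω are identified with elements of 2^ω.
Real : Set
Real = ℕ → Bool

RealSet : Set₁
RealSet = Real → Set

IsH : Real → Real → ℕ → Set
IsH x y k = (∀ i → i < k → x i ≡ y i) × (x k ≢ y k)

HSubset : RealSet → Real → Set
HSubset Y a = ∀ x y → Y x → Y y → ∀ k → IsH x y k → a k ≡ true

InRaisonnier : RealSet → Real → Set₁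
InRaisonnier X a =
  Σ (ℕ → RealSet) λ Y →
    (∀ x → X x → ∃ λ n → Y n x) × (∀ n → HSubset (Y n) a)

countBelow : Real → ℕ → ℕ
countBelow a zero = zero
countBelow a (suc m) with a m
... | true  = suc (countBelow a m)
... | false = countBelow a m

StrictlyIncreasing : (ℕ → ℕ) → Set
StrictlyIncreasing f = ∀ n → f n < f (suc n)

Rapid : (Real → Set₁) → Set₁
Rapid F = ∀ (f : ℕ → ℕ) → StrictlyIncreasing f →
  Σ Real λ a → F a × (∀ n → countBelow a (f n) ≤ n)

Partitioning : (ℕ → ℕ) → Set
Partitioning d = StrictlyIncreasing d × (d 0 ≡ 0)

blockLen : (ℕ → ℕ) → ℕ → ℕ
blockLen d n = d (suc n) ∸ d n

restrictBlock : (d : ℕ → ℕ) → Real → (n : ℕ) → Vec Bool (blockLen d n)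
restrictBlock d x n = tabulate (λ i → x (d n + toℕ i))

record BinarySlalom (d : ℕ → ℕ) : Set where
  field
    B     : (n : ℕ) → List (Vec Bool (blockLen d n))
    small : ∀ n → length (B n) ≤ n

GoesThrough : (d : ℕ → ℕ) → RealSet → BinarySlalom d → Set
GoesThrough d X S = ∀ x → X x → ∃ λ N → ∀ n → N ≤ n →
  restrictBlock d x n ∈ BinarySlalom.B S n

{-# OPTIONS --safe #-}
-- Given f, let d be the partition whose block n+1 starts at f (1² + … + (n+1)²), and B a d-binary
-- slalom that X goes through.  If x and y both pass through B from block N on and agree below d N,
-- then h(x,y) lies in a block n ≥ N, at the offset where the words x ↾ Iₙ and y ↾ Iₙ of B n first
-- differ.  Splitting X into the countably many classes "passes through B from N on, with a given
-- initial segment below d N" therefore puts a := ⋃ₙ {d n + (first difference of u, v) : u, v ∈ B n}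
-- into F_X.  Block n contributes at most n² points to a, and below f m only blocks n with
-- 1² + … + n² ≤ m occur, so |a ∩ f m| ≤ m.
module Submission where

open import Defs
open import Data.Nat using (ℕ; zero; suc; _+_; _*_; _∸_; _≤_; _<_; _≤′_; ≤′-refl; ≤′-step;
  z≤n; s≤s; s≤s⁻¹; z<s; _≟_)
open import Data.Nat.Properties
open import Data.Nat.Binary using (ℕᵇ; 2[1+_]; 1+[2_]) renaming (zero to 0ᵇ; toℕ to ℕᵇ-toℕ)
open import Data.Nat.Binary.Properties using (2[1+_]-injective; 1+[2_]-injective)
  renaming (toℕ-injective to ℕᵇ-toℕ-injective)
open import Data.Bool using (Bool; true; false; if_then_else_) renaming (_≟_ to _≟ᵇ_)
open import Data.Fin using (toℕ)
open import Data.Vec using (Vec; []; _∷_; tabulate)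
open import Data.List using (List; []; _∷_; _++_; length; map; cartesianProductWith)
open import Data.List.Properties using (length-++; length-map; ∷-injective)
open import Data.List.Membership.Propositional using (_∈_)
open import Data.List.Membership.Propositional.Properties
  using (∈-++⁺ˡ; ∈-++⁺ʳ; ∈-cartesianProductWith⁺)
open import Data.List.Membership.DecPropositional _≟_ using (_∈?_)
open import Data.List.Relation.Unary.Any using (here; there)
open import Data.Product using (Σ; ∃; _×_; _,_; proj₁; proj₂)
open import Data.Sum using (inj₁; inj₂)
open import Function using (_∘_)
open import Relation.Nullary using (yes; no; does; contradiction)
open import Relation.Nullary.Decidable using (dec-true; dec-false)
open import Relation.Binary.PropositionalEquality

module Increasing {g : ℕ → ℕ} (g-inc : StrictlyIncreasing g) where

  mono-≤ : ∀ {p q} → p ≤ q → g p ≤ g q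
  mono-≤ = go ∘ ≤⇒≤′
    where
    go : ∀ {p q} → p ≤′ q → g p ≤ g q
    go ≤′-refl      = ≤-refl
    go (≤′-step le) = ≤-trans (go le) (<⇒≤ (g-inc _))

  mono-< : ∀ {p q} → p < q → g p < g q
  mono-< {p} p<q = <-≤-trans (g-inc p) (mono-≤ p<q)

  cancel-< : ∀ {p q} → g p < g q → p < q
  cancel-< lt = ≰⇒> (λ q≤p → <⇒≱ lt (mono-≤ q≤p))

  interval-index : g 0 ≡ 0 → ∀ k → ∃ λ n → g n ≤ k × k < g (suc n)
  interval-index g0≡0 zero = 0 , ≤-reflexive g0≡0 , ≤-<-trans z≤n (g-inc 0)
  interval-index g0≡0 (suc k) with interval-index g0≡0 k
  ... | n , gn≤k , k<g[1+n] with m≤n⇒m<n∨m≡n k<g[1+n]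
  ...   | inj₁ 1+k<g[1+n] = n , m≤n⇒m≤1+n gn≤k , 1+k<g[1+n]
  ...   | inj₂ 1+k≡g[1+n] = suc n , ≤-reflexive (sym 1+k≡g[1+n]) ,
                              subst (_< g (suc (suc n))) (sym 1+k≡g[1+n]) (g-inc (suc n))

open Increasing

countBelow-suc : ∀ (a : Real) K → countBelow a K ≤ countBelow a (suc K)
countBelow-suc a K with a K
... | true  = n≤1+n _
... | false = ≤-refl

countBelow-mono : ∀ (a : Real) {K K′} → K ≤ K′ → countBelow a K ≤ countBelow a K′
countBelow-mono a = go ∘ ≤⇒≤′
  where
  go : ∀ {K K′} → K ≤′ K′ → countBelow a K ≤ countBelow a K′
  go ≤′-refl      = ≤-refl
  go (≤′-step le) = ≤-trans (go le) (countBelow-suc a _)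

remove-∈ : ∀ {A : Set} {k : A} {xs} → k ∈ xs →
  ∃ λ ys → length xs ≡ suc (length ys) × (∀ {j} → j ∈ xs → j ≢ k → j ∈ ys)
remove-∈ {xs = _ ∷ xs} (here refl) = xs , refl , λ where
  (here refl) j≢k → contradiction refl j≢k
  (there j∈xs) _  → j∈xs
remove-∈ {xs = x ∷ _} (there k∈xs) with ys , len , keep ← remove-∈ k∈xs =
  x ∷ ys , cong suc len , λ where
    (here refl) _    → here refl
    (there j∈xs) j≢k → there (keep j∈xs j≢k)

countBelow-≤-length : ∀ (a : Real) K (xs : List ℕ) →
  (∀ k → k < K → a k ≡ true → k ∈ xs) → countBelow a K ≤ length xs
countBelow-≤-length a zero xs _ = z≤n
countBelow-≤-length a (suc K) xs ⊆xs with a K in aK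
... | false = countBelow-≤-length a K xs (λ k k<K → ⊆xs k (m<n⇒m<1+n k<K))
... | true with ys , len , keep ← remove-∈ (⊆xs K ≤-refl aK) =
  subst (suc (countBelow a K) ≤_) (sym len) (s≤s (countBelow-≤-length a K ys
    (λ k k<K ak → keep (⊆xs k (m<n⇒m<1+n k<K) ak) (<⇒≢ k<K))))

sumUpTo : (ℕ → ℕ) → ℕ → ℕ
sumUpTo w zero    = w zero
sumUpTo w (suc b) = sumUpTo w b + w (suc b)

sumSquares : ℕ → ℕ
sumSquares = sumUpTo (λ n → n * n)

sumSquares-increasing : StrictlyIncreasing sumSquares
sumSquares-increasing n = m<m+n (sumSquares n) z<s

module _ (P : ℕ → List ℕ) where

  concatUpTo : ℕ → List ℕ
  concatUpTo zero    = P zero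
  concatUpTo (suc b) = concatUpTo b ++ P (suc b)

  ∈-concatUpTo : ∀ {n b k} → n ≤ b → k ∈ P n → k ∈ concatUpTo b
  ∈-concatUpTo {b = zero}  z≤n k∈ = k∈
  ∈-concatUpTo {b = suc b} n≤1+b k∈ with m≤n⇒m<n∨m≡n n≤1+b
  ... | inj₁ n<1+b = ∈-++⁺ˡ (∈-concatUpTo (s≤s⁻¹ n<1+b) k∈)
  ... | inj₂ refl  = ∈-++⁺ʳ (concatUpTo b) k∈

  length-concatUpTo : ∀ {w} → (∀ n → length (P n) ≤ w n) →
    ∀ b → length (concatUpTo b) ≤ sumUpTo w b
  length-concatUpTo      ≤w zero    = ≤w zero
  length-concatUpTo {w} ≤w (suc b) = begin
    length (concatUpTo b ++ P (suc b))         ≡⟨ length-++ (concatUpTo b) ⟩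
    length (concatUpTo b) + length (P (suc b)) ≤⟨ +-mono-≤ (length-concatUpTo ≤w b) (≤w (suc b)) ⟩
    sumUpTo w (suc b)                          ∎
    where open ≤-Reasoning

length-cartesianProductWith : ∀ {A B C : Set} (f : A → B → C) xs ys →
  length (cartesianProductWith f xs ys) ≡ length xs * length ys
length-cartesianProductWith f []       ys = refl
length-cartesianProductWith f (x ∷ xs) ys = begin
  length (map (f x) ys ++ cartesianProductWith f xs ys)
    ≡⟨ length-++ (map (f x) ys) ⟩
  length (map (f x) ys) + length (cartesianProductWith f xs ys)
    ≡⟨ cong₂ _+_ (length-map (f x) ys) (length-cartesianProductWith f xs ys) ⟩
  length ys + length xs * length ys ∎
  where open ≡-Reasoning

IsH-shift : ∀ {x y : Real} m {t} → IsH x y (m + t) → IsH (λ i → x (m + i)) (λ i → y (m + i)) t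
IsH-shift m (agree , differ) = (λ i i<t → agree (m + i) (+-monoʳ-< m i<t)) , differ

firstDifference : ∀ {L} → Vec Bool L → Vec Bool L → ℕ
firstDifference []      []      = 0
firstDifference (a ∷ u) (b ∷ v) = if does (a ≟ᵇ b) then suc (firstDifference u v) else 0

firstDifference-tabulate : ∀ {L} {x y : Real} {t} → t < L → IsH x y t →
  firstDifference {L} (tabulate (x ∘ toℕ)) (tabulate (y ∘ toℕ)) ≡ t
firstDifference-tabulate {x = x} {y} {zero} (s≤s _) (_ , differ)
  rewrite dec-false (x 0 ≟ᵇ y 0) differ = refl
firstDifference-tabulate {x = x} {y} {suc t} (s≤s t<L) h@(agree , _)
  rewrite dec-true (x 0 ≟ᵇ y 0) (agree 0 z<s) = cong suc (firstDifference-tabulate t<L (IsH-shift 1 h))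

prefix : Real → ℕ → List Bool
prefix x zero    = []
prefix x (suc L) = x 0 ∷ prefix (x ∘ suc) L

prefix-injective : ∀ {x y : Real} L M → prefix x L ≡ prefix y M →
  L ≡ M × (∀ i → i < L → x i ≡ y i)
prefix-injective zero    zero    _ = refl , λ _ ()
prefix-injective (suc L) (suc M) eq with x0≡y0 , eq′ ← ∷-injective eq
  with L≡M , agree ← prefix-injective L M eq′ = cong suc L≡M , λ where
    zero    _         → x0≡y0
    (suc i) (s≤s i<L) → agree i i<L

bitsToℕᵇ : List Bool → ℕᵇ
bitsToℕᵇ []          = 0ᵇ
bitsToℕᵇ (false ∷ l) = 1+[2 bitsToℕᵇ l ]
bitsToℕᵇ (true  ∷ l) = 2[1+ bitsToℕᵇ l ]

bitsToℕᵇ-injective : ∀ {l l′} → bitsToℕᵇ l ≡ bitsToℕᵇ l′ → l ≡ l′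
bitsToℕᵇ-injective {[]}        {[]}         _  = refl
bitsToℕᵇ-injective {false ∷ _} {false ∷ _}  eq = cong (false ∷_) (bitsToℕᵇ-injective (1+[2_]-injective eq))
bitsToℕᵇ-injective {true ∷ _}  {true ∷ _}   eq = cong (true ∷_) (bitsToℕᵇ-injective (2[1+_]-injective eq))
bitsToℕᵇ-injective {[]}        {false ∷ _}  ()
bitsToℕᵇ-injective {[]}        {true ∷ _}   ()
bitsToℕᵇ-injective {false ∷ _} {[]}         ()
bitsToℕᵇ-injective {false ∷ _} {true ∷ _}   ()
bitsToℕᵇ-injective {true ∷ _}  {[]}         ()
bitsToℕᵇ-injective {true ∷ _}  {false ∷ _}  ()

encodeBits : List Bool → ℕ
encodeBits = ℕᵇ-toℕ ∘ bitsToℕᵇ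

encodeBits-injective : ∀ {l l′} → encodeBits l ≡ encodeBits l′ → l ≡ l′
encodeBits-injective = bitsToℕᵇ-injective ∘ ℕᵇ-toℕ-injective

restrictBlock-firstDifference : ∀ d {x y : Real} {k n} → IsH x y k → d n ≤ k → k < d (suc n) →
  d n + firstDifference (restrictBlock d x n) (restrictBlock d y n) ≡ k
restrictBlock-firstDifference d {x} {y} {k} {n} h dn≤k k<d[1+n] = begin
  d n + firstDifference (restrictBlock d x n) (restrictBlock d y n)
    ≡⟨ cong (d n +_) (firstDifference-tabulate (∸-monoˡ-< k<d[1+n] dn≤k)
                       (IsH-shift (d n) (subst (IsH x y) (sym (m+[n∸m]≡n dn≤k)) h))) ⟩
  d n + (k ∸ d n)
    ≡⟨ m+[n∸m]≡n dn≤k ⟩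
  k ∎
  where open ≡-Reasoning

module SlalomSet (d : ℕ → ℕ) (d-part : Partitioning d) (S : BinarySlalom d) where

  open BinarySlalom S

  d-inc : StrictlyIncreasing d
  d-inc = proj₁ d-part

  hValues : ℕ → List ℕ
  hValues n = cartesianProductWith (λ u v → d n + firstDifference u v) (B n) (B n)

  length-hValues : ∀ n → length (hValues n) ≤ n * n
  length-hValues n = ≤-trans (≤-reflexive (length-cartesianProductWith _ (B n) (B n)))
                             (*-mono-≤ (small n) (small n))

  block : ∀ k → ∃ λ n → d n ≤ k × k < d (suc n)
  block = interval-index d-inc (proj₂ d-part)

  blockOf : ℕ → ℕ
  blockOf k = proj₁ (block k)

  blockOf-≥ : ∀ {N k} → d N ≤ k → N ≤ blockOf k
  blockOf-≥ {k = k} dN≤k = s≤s⁻¹ (cancel-< d-inc (≤-<-trans dN≤k (proj₂ (proj₂ (block k)))))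

  blockOf-≤ : ∀ {k b} → k < d (suc b) → blockOf k ≤ b
  blockOf-≤ {k} k<d[1+b] =
    s≤s⁻¹ (cancel-< d-inc (≤-<-trans (proj₁ (proj₂ (block k))) k<d[1+b]))

  hSet : Real
  hSet k = does (k ∈? hValues (blockOf k))

  hSet⇒∈ : ∀ {k} → hSet k ≡ true → k ∈ hValues (blockOf k)
  hSet⇒∈ {k} _ with k ∈? hValues (blockOf k)
  hSet⇒∈ _  | yes k∈ = k∈
  hSet⇒∈ () | no _

  -- The index j codes the initial segment x ↾ d N, whose length recovers d N.
  Piece : ℕ → RealSet
  Piece j x = ∃ λ N → encodeBits (prefix x (d N)) ≡ j
                    × (∀ n → N ≤ n → restrictBlock d x n ∈ B n)

  H[Piece]⊆hSet : ∀ j → HSubset (Piece j) hSet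
  H[Piece]⊆hSet _ x y (N , refl , x∈B) (N′ , code≡ , y∈B) k h@(_ , differ)
    with dN≡dN′ , agree ← prefix-injective (d N) (d N′) (encodeBits-injective (sym code≡)) =
    dec-true (k ∈? hValues n) k∈hValues
    where
    n : ℕ
    n = blockOf k
    dn≤k : d n ≤ k
    dn≤k = proj₁ (proj₂ (block k))
    k<d[1+n] : k < d (suc n)
    k<d[1+n] = proj₂ (proj₂ (block k))
    dN≤k : d N ≤ k
    dN≤k = ≮⇒≥ (λ k<dN → differ (agree k k<dN))
    dN′≤k : d N′ ≤ k
    dN′≤k = subst (_≤ k) dN≡dN′ dN≤k
    k∈hValues : k ∈ hValues n
    k∈hValues = subst (_∈ hValues n) (restrictBlock-firstDifference d h dn≤k k<d[1+n])
      (∈-cartesianProductWith⁺ (λ u v → d n + firstDifference u v)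
        (x∈B n (blockOf-≥ dN≤k)) (y∈B n (blockOf-≥ dN′≤k)))

  hSet-∈-Raisonnier : ∀ {X} → GoesThrough d X S → InRaisonnier X hSet
  hSet-∈-Raisonnier {X} goes = Piece , cover , H[Piece]⊆hSet
    where
    cover : ∀ x → X x → ∃ λ j → Piece j x
    cover x Xx with N , x∈B ← goes x Xx = encodeBits (prefix x (d N)) , N , refl , x∈B

  countBelow-hSet : ∀ b → countBelow hSet (d (suc b)) ≤ sumSquares b
  countBelow-hSet b = begin
    countBelow hSet (d (suc b))   ≤⟨ countBelow-≤-length hSet (d (suc b)) (concatUpTo hValues b) below⊆ ⟩
    length (concatUpTo hValues b) ≤⟨ length-concatUpTo hValues length-hValues b ⟩
    sumSquares b                  ∎
    where
    open ≤-Reasoning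
    below⊆ : ∀ k → k < d (suc b) → hSet k ≡ true → k ∈ concatUpTo hValues b
    below⊆ k k<d[1+b] k∈hSet = ∈-concatUpTo hValues (blockOf-≤ k<d[1+b]) (hSet⇒∈ k∈hSet)

partitionAlong : (ℕ → ℕ) → ℕ → ℕ
partitionAlong f zero    = 0
partitionAlong f (suc n) = f (sumSquares (suc n))

partitionAlong-partitioning : ∀ {f} → StrictlyIncreasing f → Partitioning (partitionAlong f)
partitionAlong-partitioning f-inc = increasing , refl
  where
  increasing : StrictlyIncreasing (partitionAlong _)
  increasing zero    = ≤-<-trans z≤n (f-inc 0)
  increasing (suc n) = mono-< f-inc (sumSquares-increasing (suc n))

lemma4p7 : (X : RealSet) →
    ((d : ℕ → ℕ) → Partitioning d → Σ (BinarySlalom d) λ S → GoesThrough d X S) →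
    Rapid (InRaisonnier X)
lemma4p7 X slalom f f-inc = hSet , hSet-∈-Raisonnier goes , bound
  where
  d : ℕ → ℕ
  d = partitionAlong f
  d-part : Partitioning d
  d-part = partitionAlong-partitioning f-inc
  S : BinarySlalom d
  S = proj₁ (slalom d d-part)
  goes : GoesThrough d X S
  goes = proj₂ (slalom d d-part)
  open SlalomSet d d-part S

  bound : ∀ m → countBelow hSet (f m) ≤ m
  bound m with b , Tb≤m , m<T[1+b] ← interval-index sumSquares-increasing refl m = begin
    countBelow hSet (f m)       ≤⟨ countBelow-mono hSet (mono-≤ f-inc (<⇒≤ m<T[1+b])) ⟩
    countBelow hSet (d (suc b)) ≤⟨ countBelow-hSet b ⟩
    sumSquares b                ≤⟨ Tb≤m ⟩
    m                           ∎
    where open ≤-Reasoning
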